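{- Let $\mathbb A=(A,+)$ be a cancellative semigroup and let $X,Y$ be non-empty finite subsets of $A$ with $|X+Y|<\omega(Y)$ and $\langle Y\rangle$ commutative. Let $k:=|X|$, $\ell:=|Y|$, let $x_1,\dots,x_k$ be an enumeration of $X$ and $y_1,\dots,y_\ell$ an enumeration of $Y$, and let $\alpha(X,Y)$ be the $k\times\ell$ matrix whose $(i,j)$ entry is $x_i+y_j$. Let $Z$ be any subset of $X+Y$ with $|Z|=\ell-1$. Then one can choose one entry $z_i$ from the $i$-th row of $\alpha(X,Y)$ for each $i=1,\dots,k$ such that $Z\cup\{z_1,\dots,z_k\}$ is a subset of $X+Y$ of size $k+\ell-1$.
   Context: Semigroups are written additively and need not be commutative; cancellative means $z+x=z+y$ or $x+z=y+z$ implies $x=y$. $X+Y:=\{x+y:x\in X,y\in Y\}$. $A^\times$ is the set of units if $\mathbb A$ is a monoid and $\emptyset$ otherwise. $\langle S\rangle$ is the subsemigroup generated by $S$ and $\mathrm{ord}(z):=|\langle\{z\}\rangle|$. For a unit $y_0$ with inverse $\tilde y_0$, $y-y_0:=y+\tilde y_0$. $\omega(Y):=\sup_{y_0\in Y\cap A^\times}\inf_{y\in Y\setminus\{y_0\}}\mathrm{ord}(y-y_0)$, with $\sup\emptyset=0$ and $\inf\emptyset=|\mathbb N|$. -}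

module Defs where

open import Level using (Level; _⊔_)
open import Data.Nat using (ℕ; zero; suc)
open import Data.Fin using (Fin)
open import Data.Product using (Σ; ∃; _×_; _,_)
open import Relation.Nullary using (¬_)
open import Relation.Binary.PropositionalEquality using (_≡_)
open import Relation.Unary using (Pred)
open import Algebra.Bundles using (Semigroup)
import Algebra.Definitions as AD

module _ {c ℓ : Level} (S : Semigroup c ℓ) where
  open Semigroup S

  IsCancellative : Set (c ⊔ ℓ)
  IsCancellative = AD.Cancellative _≈_ _∙_

  InjectiveEnum : {n : ℕ} → (Fin n → Carrier) → Set ℓ
  InjectiveEnum f = ∀ i j → f i ≈ f j → i ≡ j

  Img : {n : ℕ} → (Fin n → Carrier) → Pred Carrier ℓ
  Img f a = ∃ λ i → a ≈ f i

  Sumset : {k l : ℕ} → (Fin k → Carrier) → (Fin l → Carrier) → Pred Carrier ℓ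
  Sumset x y a = ∃ λ i → ∃ λ j → a ≈ (x i ∙ y j)

  data Gen {p : Level} (P : Pred Carrier p) : Pred Carrier (c ⊔ ℓ ⊔ p) where
    base : ∀ {a} → P a → Gen P a
    add  : ∀ {a b} → Gen P a → Gen P b → Gen P (a ∙ b)
    resp : ∀ {a b} → a ≈ b → Gen P a → Gen P b

  Commutative : {p : Level} → Pred Carrier p → Set (c ⊔ ℓ ⊔ p)
  Commutative P = ∀ a b → P a → P b → (a ∙ b) ≈ (b ∙ a)

  HasSize : {p : Level} → Pred Carrier p → ℕ → Set (c ⊔ ℓ ⊔ p)
  HasSize P n = Σ (Fin n → Carrier) λ f →
    (∀ i → P (f i)) × InjectiveEnum f × (∀ a → P a → ∃ λ i → a ≈ f i)

  AtLeast : {p : Level} → Pred Carrier p → ℕ → Set (c ⊔ ℓ ⊔ p)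
  AtLeast P n = Σ (Fin n → Carrier) λ f → (∀ i → P (f i)) × InjectiveEnum f

  OrdGT : ℕ → Carrier → Set (c ⊔ ℓ)
  OrdGT n z = AtLeast (Gen (λ a → a ≈ z)) (suc n)

  IsIdentity : Carrier → Set (c ⊔ ℓ)
  IsIdentity e = ∀ a → ((e ∙ a) ≈ a) × ((a ∙ e) ≈ a)

  -- Unfolding of ω(Y) = sup_{y0 ∈ Y ∩ A^×} inf_{y ∈ Y∖{y0}} ord(y - y0):
  -- there is an identity e and y0 = y j0 ∈ Y with two-sided inverse ỹ,
  -- such that n < ord(y + ỹ) for every y ∈ Y with y ≉ y0.
  -- (sup ∅ = 0 makes this false when A^× ∩ Y = ∅; inf ∅ = |ℕ| > n.)
  OmegaGT : ℕ → {l : ℕ} → (Fin l → Carrier) → Set (c ⊔ ℓ)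
  OmegaGT n {l} y = Σ Carrier λ e → IsIdentity e × (Σ (Fin l) λ j0 → Σ Carrier λ ỹ →
    ((y j0 ∙ ỹ) ≈ e) × ((ỹ ∙ y j0) ≈ e) ×
    (∀ j → ¬ (y j ≈ y j0) → OrdGT n (y j ∙ ỹ)))

-- Hall's marriage theorem reduces the claim to |N(I) ∖ Z| ≥ |I| for every set I of rows of α(X, Y),
-- where N(I) = X_I + Y is the set of entries in these rows. As |Z| = |Y| − 1, this follows from the
-- Cauchy–Davenport-type bound |X_I + Y| ≥ |X_I| + |Y| − 1. That bound is proved by Dyson's e-transform,
-- translating by the differences y − y₀ (y₀ the unit realising ω(Y)), which commute because ⟨Y⟩ does.
-- The transform only gets stuck when X_I + y₀ is invariant under translation by some y − y₀ ≠ 0; then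
-- an orbit inside X + Y closes up and ord(y − y₀) ≤ |X + Y| < ω(Y), a contradiction.

module Submission where

open import Defs
open import Level using (Level)
open import Algebra.Bundles using (Semigroup)
open import Algebra.Definitions using (LeftCancellative)
open import Data.Nat using (ℕ; zero; suc; _+_; _∸_; _≤_; _<_; _≤?_; z≤n; s≤s)
open import Data.Nat.Properties
  using ( ≤-trans; ≤-reflexive; ≤-pred; ≤-<-trans; <-irrefl; n<1+n; ≰⇒>; >⇒≢; ≮⇒≥; <⇒≱; n≤0⇒n≡0
        ; m≤n⇒m<n∨m≡n; m≤n⇒∃[o]m+o≡n; m≤m+n; +-comm; +-assoc; +-suc; +-identityʳ; +-mono-≤; +-monoˡ-≤
        ; +-monoʳ-≤; +-cancelˡ-≤; +-cancelʳ-≤; m+[n∸m]≡n; +-∸-assoc; module ≤-Reasoning)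
open import Data.Nat.Induction using (<-wellFounded)
open import Data.Fin using (Fin; zero; suc; _≟_; toℕ; fromℕ<; splitAt; join; _↑ˡ_; _↑ʳ_)
open import Data.Fin.Properties
  using (any?; suc-injective; pigeonhole; toℕ<n; toℕ-fromℕ<; splitAt-↑ˡ; splitAt-↑ʳ; join-splitAt)
open import Data.Fin.Subset
open import Data.Fin.Subset.Properties
open import Data.Vec using (_∷_; []; tabulate; here; there)
open import Data.Vec.Properties using (lookup∘tabulate; []=⇒lookup; lookup⇒[]=)
open import Data.Product using (∃; _×_; _,_; proj₁; proj₂)
open import Data.Sum using (_⊎_; inj₁; inj₂; [_,_]′)
open import Data.Empty using (⊥-elim)
open import Function using (_∘_; Injective)
open import Induction.WellFounded using (Acc; acc)
open import Relation.Nullary using (¬_; does; yes; no; Dec; contradiction)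
open import Relation.Nullary.Decidable using (_×-dec_; ¬?; dec-true; decidable-stable)
open import Relation.Unary using (Pred; Decidable)
open import Relation.Binary.PropositionalEquality
  using (_≡_; _≢_; refl; sym; trans; cong; subst; module ≡-Reasoning)

private variable
  ℓ : Level
  m n : ℕ

-- Counting subsets of Fin n

∣p∪q∣+∣p∩q∣≡∣p∣+∣q∣ : (p q : Subset n) → ∣ p ∪ q ∣ + ∣ p ∩ q ∣ ≡ ∣ p ∣ + ∣ q ∣
∣p∪q∣+∣p∩q∣≡∣p∣+∣q∣ [] [] = refl
∣p∪q∣+∣p∩q∣≡∣p∣+∣q∣ (outside ∷ p) (outside ∷ q) = ∣p∪q∣+∣p∩q∣≡∣p∣+∣q∣ p q
∣p∪q∣+∣p∩q∣≡∣p∣+∣q∣ (outside ∷ p) (inside ∷ q) =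
  trans (cong suc (∣p∪q∣+∣p∩q∣≡∣p∣+∣q∣ p q)) (sym (+-suc _ _))
∣p∪q∣+∣p∩q∣≡∣p∣+∣q∣ (inside ∷ p) (outside ∷ q) = cong suc (∣p∪q∣+∣p∩q∣≡∣p∣+∣q∣ p q)
∣p∪q∣+∣p∩q∣≡∣p∣+∣q∣ (inside ∷ p) (inside ∷ q) =
  cong suc (trans (+-suc _ _) (trans (cong suc (∣p∪q∣+∣p∩q∣≡∣p∣+∣q∣ p q)) (sym (+-suc _ _))))

∣p∪q∣≤∣p∣+∣q∣ : (p q : Subset n) → ∣ p ∪ q ∣ ≤ ∣ p ∣ + ∣ q ∣
∣p∪q∣≤∣p∣+∣q∣ p q = ≤-trans (m≤m+n _ _) (≤-reflexive (∣p∪q∣+∣p∩q∣≡∣p∣+∣q∣ p q))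

Disjoint : Subset n → Subset n → Set
Disjoint p q = ∀ {x} → x ∈ p → x ∉ q

disjoint⇒∣p∣+∣q∣≡∣p∪q∣ : (p q : Subset n) → Disjoint p q → ∣ p ∣ + ∣ q ∣ ≡ ∣ p ∪ q ∣
disjoint⇒∣p∣+∣q∣≡∣p∪q∣ {n} p q p#q = begin
  ∣ p ∣ + ∣ q ∣           ≡⟨ ∣p∪q∣+∣p∩q∣≡∣p∣+∣q∣ p q ⟨
  ∣ p ∪ q ∣ + ∣ p ∩ q ∣   ≡⟨ cong (∣ p ∪ q ∣ +_) ∣p∩q∣≡0 ⟩
  ∣ p ∪ q ∣ + 0           ≡⟨ +-identityʳ _ ⟩
  ∣ p ∪ q ∣               ∎
  where
  open ≡-Reasoning
  ∣p∩q∣≡0 : ∣ p ∩ q ∣ ≡ 0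
  ∣p∩q∣≡0 = n≤0⇒n≡0 (≤-trans (p⊆q⇒∣p∣≤∣q∣ {p = p ∩ q} {q = ⊥} λ x∈p∩q →
    let x∈p , x∈q = x∈p∩q⁻ p q x∈p∩q in contradiction x∈q (p#q x∈p)) (≤-reflexive (∣⊥∣≡0 n)))

x∈p─q⁻ : ∀ {x : Fin n} (p q : Subset n) → x ∈ p ─ q → x ∈ p × x ∉ q
x∈p─q⁻ (inside  ∷ p) (outside ∷ q) here = here , λ ()
x∈p─q⁻ {x = zero} (inside  ∷ p) (inside  ∷ q) ()
x∈p─q⁻ {x = zero} (outside ∷ p) (inside  ∷ q) ()
x∈p─q⁻ {x = zero} (outside ∷ p) (outside ∷ q) ()
x∈p─q⁻ (_ ∷ p) (_ ∷ q) (there x∈p─q) =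
  let x∈p , x∉q = x∈p─q⁻ p q x∈p─q in there x∈p , x∉q ∘ drop-there

Empty⇒∣p∣≡0 : {p : Subset n} → Empty p → ∣ p ∣ ≡ 0
Empty⇒∣p∣≡0 {n} p-empty rewrite Empty-unique p-empty = ∣⊥∣≡0 n

0<∣p∣⇒Nonempty : {p : Subset n} → 0 < ∣ p ∣ → Nonempty p
0<∣p∣⇒Nonempty {p = p} 0<∣p∣ with nonempty? p
... | yes p-nonempty = p-nonempty
... | no  p-empty    = contradiction (Empty⇒∣p∣≡0 p-empty) (>⇒≢ 0<∣p∣)

∪-least : {p q r : Subset n} → p ⊆ r → q ⊆ r → p ∪ q ⊆ r
∪-least {p = p} {q} p⊆r q⊆r x∈p∪q = [ p⊆r , q⊆r ]′ (x∈p∪q⁻ p q x∈p∪q)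

p⊆q∪p─q : (p q : Subset n) → p ⊆ q ∪ (p ─ q)
p⊆q∪p─q p q {x} x∈p with x ∈? q
... | yes x∈q = x∈p∪q⁺ (inj₁ x∈q)
... | no  x∉q = x∈p∪q⁺ (inj₂ (x∈p∧x∉q⇒x∈p─q x∈p x∉q))

fromDec : {P : Pred (Fin n) ℓ} → Decidable P → Subset n
fromDec P? = tabulate (λ i → does (P? i))

module _ {P : Pred (Fin n) ℓ} (P? : Decidable P) {i : Fin n} where

  ∈-fromDec⁺ : P i → i ∈ fromDec P?
  ∈-fromDec⁺ Pi = lookup⇒[]= i _ (trans (lookup∘tabulate _ i) (dec-true (P? i) Pi))

  ∈-fromDec⁻ : i ∈ fromDec P? → P i
  ∈-fromDec⁻ i∈ with P? i | trans (sym (lookup∘tabulate (λ i → does (P? i)) i)) ([]=⇒lookup i∈)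
  ... | yes Pi | _  = Pi
  ... | no _   | ()

module _ (f : Fin m → Fin n) where

  hasPreimage? : (p : Subset m) → Decidable (λ y → ∃ λ x → x ∈ p × f x ≡ y)
  hasPreimage? p y = any? (λ x → x ∈? p ×-dec f x ≟ y)

  image : Subset m → Subset n
  image p = fromDec (hasPreimage? p)

  ∈-image⁺ : {p : Subset m} {x : Fin m} → x ∈ p → f x ∈ image p
  ∈-image⁺ {p} x∈p = ∈-fromDec⁺ (hasPreimage? p) (_ , x∈p , refl)

  ∈-image⁻ : {p : Subset m} {y : Fin n} → y ∈ image p → ∃ λ x → x ∈ p × f x ≡ y
  ∈-image⁻ {p} = ∈-fromDec⁻ (hasPreimage? p)

  image-mono : {p q : Subset m} → p ⊆ q → image p ⊆ image q
  image-mono p⊆q y∈fp = let x , x∈p , fx≡y = ∈-image⁻ y∈fp in subst (_∈ image _) fx≡y (∈-image⁺ (p⊆q x∈p))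

  preimage : Subset m → Fin m → Fin n → Fin m
  preimage p default y with hasPreimage? p y
  ... | yes (x , _) = x
  ... | no _        = default

  preimage-spec : {p : Subset m} (default : Fin m) {y : Fin n} → y ∈ image p →
                  preimage p default y ∈ p × f (preimage p default y) ≡ y
  preimage-spec {p} default {y} y∈fp with hasPreimage? p y
  ... | yes (_ , spec) = spec
  ... | no ∄x          = contradiction (∈-image⁻ y∈fp) ∄x

module _ (f : Fin (suc m) → Fin n) {p : Subset m} where

  image-outside∷ : image f (outside ∷ p) ⊆ image (f ∘ suc) p
  image-outside∷ y∈ with ∈-image⁻ f {p = outside ∷ p} y∈
  ... | suc x , there x∈p , refl = ∈-image⁺ (f ∘ suc) x∈p

  image-∷ : ∀ {s} → image f (s ∷ p) ⊆ ⁅ f zero ⁆ ∪ image (f ∘ suc) p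
  image-∷ {s} y∈ with ∈-image⁻ f {p = s ∷ p} y∈
  ... | zero  , _          , refl = x∈p∪q⁺ (inj₁ (x∈⁅x⁆ (f zero)))
  ... | suc x , there x∈p , refl = x∈p∪q⁺ (inj₂ (∈-image⁺ (f ∘ suc) x∈p))

  image-suc : ∀ {s} → image (f ∘ suc) p ⊆ image f (s ∷ p)
  image-suc y∈ with ∈-image⁻ (f ∘ suc) {p = p} y∈
  ... | x , x∈p , refl = ∈-image⁺ f (there x∈p)

∣image∣≤∣p∣ : (f : Fin m → Fin n) (p : Subset m) → ∣ image f p ∣ ≤ ∣ p ∣
∣image∣≤∣p∣ {n = n} f [] = ≤-trans (p⊆q⇒∣p∣≤∣q∣ image-[]) (≤-reflexive (∣⊥∣≡0 n))
  where
  image-[] : image f [] ⊆ ⊥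
  image-[] y∈ with () ← proj₁ (∈-image⁻ f {p = []} y∈)
∣image∣≤∣p∣ f (outside ∷ p) = ≤-trans (p⊆q⇒∣p∣≤∣q∣ (image-outside∷ f {p})) (∣image∣≤∣p∣ (f ∘ suc) p)
∣image∣≤∣p∣ f (inside ∷ p) = begin
  ∣ image f (inside ∷ p) ∣             ≤⟨ p⊆q⇒∣p∣≤∣q∣ (image-∷ f {p} {inside}) ⟩
  ∣ ⁅ f zero ⁆ ∪ image (f ∘ suc) p ∣   ≤⟨ ∣p∪q∣≤∣p∣+∣q∣ ⁅ f zero ⁆ (image (f ∘ suc) p) ⟩
  ∣ ⁅ f zero ⁆ ∣ + ∣ image (f ∘ suc) p ∣ ≡⟨ cong (_+ ∣ image (f ∘ suc) p ∣) (∣⁅x⁆∣≡1 (f zero)) ⟩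
  suc ∣ image (f ∘ suc) p ∣            ≤⟨ s≤s (∣image∣≤∣p∣ (f ∘ suc) p) ⟩
  suc ∣ p ∣                            ∎
  where open ≤-Reasoning

InjectiveOn : (Fin m → Fin n) → Subset m → Set
InjectiveOn f p = ∀ {x y} → x ∈ p → y ∈ p → f x ≡ f y → x ≡ y

injective-suc : {f : Fin (suc m) → Fin n} {p : Subset m} {s : Side} →
                InjectiveOn f (s ∷ p) → InjectiveOn (f ∘ suc) p
injective-suc f-inj x∈p y∈p eq = suc-injective (f-inj (there x∈p) (there y∈p) eq)

∣p∣≤∣image∣ : (f : Fin m → Fin n) (p : Subset m) → InjectiveOn f p → ∣ p ∣ ≤ ∣ image f p ∣
∣p∣≤∣image∣ f [] _ = z≤n
∣p∣≤∣image∣ f (outside ∷ p) f-inj =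
  ≤-trans (∣p∣≤∣image∣ (f ∘ suc) p (injective-suc f-inj)) (p⊆q⇒∣p∣≤∣q∣ (image-suc f {p} {outside}))
∣p∣≤∣image∣ f (inside ∷ p) f-inj = begin
  suc ∣ p ∣                              ≤⟨ s≤s (∣p∣≤∣image∣ (f ∘ suc) p (injective-suc f-inj)) ⟩
  suc ∣ image (f ∘ suc) p ∣              ≡⟨ cong (_+ ∣ image (f ∘ suc) p ∣) (∣⁅x⁆∣≡1 (f zero)) ⟨
  ∣ ⁅ f zero ⁆ ∣ + ∣ image (f ∘ suc) p ∣ ≡⟨ disjoint⇒∣p∣+∣q∣≡∣p∪q∣ _ _ f0∉image ⟩
  ∣ ⁅ f zero ⁆ ∪ image (f ∘ suc) p ∣     ≤⟨ p⊆q⇒∣p∣≤∣q∣ (∪-least f0∈image (image-suc f {p} {inside})) ⟩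
  ∣ image f (inside ∷ p) ∣               ∎
  where
  open ≤-Reasoning
  f0∈image : ⁅ f zero ⁆ ⊆ image f (inside ∷ p)
  f0∈image y∈ rewrite x∈⁅y⁆⇒x≡y (f zero) y∈ = ∈-image⁺ f here
  f0∉image : Disjoint ⁅ f zero ⁆ (image (f ∘ suc) p)
  f0∉image {y} y∈ y∈image with ∈-image⁻ (f ∘ suc) {p} y∈image
  ... | x , x∈p , fx≡y with () ← f-inj here (there x∈p) (sym (trans fx≡y (x∈⁅y⁆⇒x≡y {x = y} (f zero) y∈)))


-- Hall's marriage theorem

module _ {r : Level} {k s : ℕ} (R : Fin k → Fin s → Set r) (R? : ∀ i m → Dec (R i m)) where

  hasNeighbourIn? : (I : Subset k) (m : Fin s) → Dec (∃ λ i → i ∈ I × R i m)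
  hasNeighbourIn? I m = any? (λ i → i ∈? I ×-dec R? i m)

  neighbours : Subset k → Subset s
  neighbours I = fromDec (hasNeighbourIn? I)

  ∈-neighbours⁺ : ∀ {I i m} → i ∈ I → R i m → m ∈ neighbours I
  ∈-neighbours⁺ {I} i∈I Rim = ∈-fromDec⁺ (hasNeighbourIn? I) (_ , i∈I , Rim)

  ∈-neighbours⁻ : ∀ {I m} → m ∈ neighbours I → ∃ λ i → i ∈ I × R i m
  ∈-neighbours⁻ {I} = ∈-fromDec⁻ (hasNeighbourIn? I)

  neighbours-mono : ∀ {I J} → I ⊆ J → neighbours I ⊆ neighbours J
  neighbours-mono I⊆J m∈NI = let i , i∈I , Rim = ∈-neighbours⁻ m∈NI in ∈-neighbours⁺ (I⊆J i∈I) Rim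

  HallCondition : Subset k → Subset s → Set
  HallCondition A B = ∀ I → I ⊆ A → ∣ I ∣ ≤ ∣ B ∩ neighbours I ∣

  record Matching (A : Subset k) (B : Subset s) : Set r where
    field
      match     : Fin k → Fin s
      match-∈   : ∀ {i} → i ∈ A → match i ∈ B
      match-R   : ∀ {i} → i ∈ A → R i (match i)
      match-inj : InjectiveOn match A

  emptyMatching : ∀ {A B} → Fin s → Empty A → Matching A B
  emptyMatching d A-empty = record
    { match     = λ _ → d
    ; match-∈   = λ i∈A → contradiction (_ , i∈A) A-empty
    ; match-R   = λ i∈A → contradiction (_ , i∈A) A-empty
    ; match-inj = λ i∈A _ _ → contradiction (_ , i∈A) A-empty
    }

  singletonMatching : ∀ {i a} → R i a → Matching ⁅ i ⁆ ⁅ a ⁆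
  singletonMatching {i} {a} Ria = record
    { match     = λ _ → a
    ; match-∈   = λ _ → x∈⁅x⁆ a
    ; match-R   = λ j∈⁅i⁆ → subst (λ j → R j a) (sym (x∈⁅y⁆⇒x≡y i j∈⁅i⁆)) Ria
    ; match-inj = λ j∈⁅i⁆ j′∈⁅i⁆ _ → trans (x∈⁅y⁆⇒x≡y i j∈⁅i⁆) (sym (x∈⁅y⁆⇒x≡y i j′∈⁅i⁆))
    }

  glueMatchings : ∀ {A B A₁ B₁ A₂ B₂} → Matching A₁ B₁ → Matching A₂ B₂ →
                  A ⊆ A₁ ∪ A₂ → B₁ ⊆ B → B₂ ⊆ B → Disjoint B₁ B₂ → Matching A B
  glueMatchings {A} {B} {A₁} {B₁} {A₂} {B₂} M₁ M₂ A⊆A₁∪A₂ B₁⊆B B₂⊆B B₁#B₂ = record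
    { match = match ; match-∈ = match-∈ ; match-R = match-R ; match-inj = match-inj }
    where
    module M₁ = Matching M₁
    module M₂ = Matching M₂

    ∈A₂ : ∀ {i} → i ∈ A → i ∉ A₁ → i ∈ A₂
    ∈A₂ i∈A i∉A₁ = [ (λ i∈A₁ → contradiction i∈A₁ i∉A₁) , (λ i∈A₂ → i∈A₂) ]′ (x∈p∪q⁻ A₁ A₂ (A⊆A₁∪A₂ i∈A))

    match : Fin k → Fin s
    match i with i ∈? A₁
    ... | yes _ = M₁.match i
    ... | no  _ = M₂.match i

    match-∈ : ∀ {i} → i ∈ A → match i ∈ B
    match-∈ {i} i∈A with i ∈? A₁
    ... | yes i∈A₁ = B₁⊆B (M₁.match-∈ i∈A₁)
    ... | no  i∉A₁ = B₂⊆B (M₂.match-∈ (∈A₂ i∈A i∉A₁))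

    match-R : ∀ {i} → i ∈ A → R i (match i)
    match-R {i} i∈A with i ∈? A₁
    ... | yes i∈A₁ = M₁.match-R i∈A₁
    ... | no  i∉A₁ = M₂.match-R (∈A₂ i∈A i∉A₁)

    match-inj : InjectiveOn match A
    match-inj {i} {j} i∈A j∈A eq with i ∈? A₁ | j ∈? A₁
    ... | yes i∈A₁ | yes j∈A₁ = M₁.match-inj i∈A₁ j∈A₁ eq
    ... | no  i∉A₁ | no  j∉A₁ = M₂.match-inj (∈A₂ i∈A i∉A₁) (∈A₂ j∈A j∉A₁) eq
    ... | yes i∈A₁ | no  j∉A₁ =
      contradiction (M₂.match-∈ (∈A₂ j∈A j∉A₁)) (B₁#B₂ (subst (_∈ B₁) eq (M₁.match-∈ i∈A₁)))
    ... | no  i∉A₁ | yes j∈A₁ =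
      contradiction (M₂.match-∈ (∈A₂ i∈A i∉A₁)) (B₁#B₂ (subst (_∈ B₁) (sym eq) (M₁.match-∈ j∈A₁)))

  Tight : Subset k → Subset s → Subset k → Set
  Tight A B I = I ⊂ A × Nonempty I × ∣ B ∩ neighbours I ∣ ≤ ∣ I ∣

  tight? : ∀ A B I → Dec (Tight A B I)
  tight? A B I = (I ⊆? A ×-dec any? (λ x → x ∈? A ×-dec ¬? (x ∈? I)))
           ×-dec nonempty? I
           ×-dec ∣ B ∩ neighbours I ∣ ≤? ∣ I ∣

  SmallerMatchings : Subset k → Set r
  SmallerMatchings A = ∀ {A′} B′ → ∣ A′ ∣ < ∣ A ∣ → HallCondition A′ B′ → Matching A′ B′

  -- A tight set I is matched into its own neighbourhood, the rest of A into what remains.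
  tightMatching : ∀ {A B I} → SmallerMatchings A → HallCondition A B → Tight A B I → Matching A B
  tightMatching {A} {B} {I} smaller hc (I⊂A@(I⊆A , _) , (i , i∈I) , tight) =
    glueMatchings M₁ M₂ (p⊆q∪p─q A I) (p∩q⊆p B N) (p─q⊆p B N) B∩N#B─N
    where
    N = neighbours I

    hc₁ : HallCondition I (B ∩ N)
    hc₁ J J⊆I = ≤-trans (hc J (I⊆A ∘ J⊆I)) (p⊆q⇒∣p∣≤∣q∣ B∩NJ⊆B∩N∩NJ)
      where
      B∩NJ⊆B∩N∩NJ : B ∩ neighbours J ⊆ (B ∩ N) ∩ neighbours J
      B∩NJ⊆B∩N∩NJ m∈ = let m∈B , m∈NJ = x∈p∩q⁻ B _ m∈ in
        x∈p∩q⁺ (x∈p∩q⁺ (m∈B , neighbours-mono J⊆I m∈NJ) , m∈NJ)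

    hc₂ : HallCondition (A ─ I) (B ─ N)
    hc₂ J J⊆A─I = +-cancelˡ-≤ ∣ I ∣ _ _ (begin
      ∣ I ∣ + ∣ J ∣                                  ≡⟨ disjoint⇒∣p∣+∣q∣≡∣p∪q∣ I J I#J ⟩
      ∣ I ∪ J ∣                                      ≤⟨ hc (I ∪ J) (∪-least I⊆A (p─q⊆p A I ∘ J⊆A─I)) ⟩
      ∣ B ∩ neighbours (I ∪ J) ∣                     ≤⟨ p⊆q⇒∣p∣≤∣q∣ split ⟩
      ∣ (B ∩ N) ∪ ((B ─ N) ∩ neighbours J) ∣         ≤⟨ ∣p∪q∣≤∣p∣+∣q∣ (B ∩ N) _ ⟩
      ∣ B ∩ N ∣ + ∣ (B ─ N) ∩ neighbours J ∣         ≤⟨ +-monoˡ-≤ _ tight ⟩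
      ∣ I ∣ + ∣ (B ─ N) ∩ neighbours J ∣             ∎)
      where
      open ≤-Reasoning
      I#J : Disjoint I J
      I#J x∈I x∈J = proj₂ (x∈p─q⁻ A I (J⊆A─I x∈J)) x∈I
      split : B ∩ neighbours (I ∪ J) ⊆ (B ∩ N) ∪ ((B ─ N) ∩ neighbours J)
      split {m} m∈ with x∈p∩q⁻ B _ m∈ | m ∈? N
      ... | m∈B , _      | yes m∈N = x∈p∪q⁺ (inj₁ (x∈p∩q⁺ (m∈B , m∈N)))
      ... | m∈B , m∈NI∪J | no  m∉N with ∈-neighbours⁻ m∈NI∪J
      ...   | i , i∈I∪J , Rim = [ (λ i∈I → contradiction (∈-neighbours⁺ i∈I Rim) m∉N)
                                , (λ i∈J → x∈p∪q⁺ (inj₂ (x∈p∩q⁺ (x∈p∧x∉q⇒x∈p─q m∈B m∉N , ∈-neighbours⁺ i∈J Rim))))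
                                ]′ (x∈p∪q⁻ I J i∈I∪J)

    M₁ : Matching I (B ∩ N)
    M₁ = smaller (B ∩ N) (p⊂q⇒∣p∣<∣q∣ I⊂A) hc₁

    M₂ : Matching (A ─ I) (B ─ N)
    M₂ = smaller (B ─ N) (p∩q≢∅⇒∣p─q∣<∣p∣ A I (i , x∈p∩q⁺ (I⊆A i∈I , i∈I))) hc₂

    B∩N#B─N : Disjoint (B ∩ N) (B ─ N)
    B∩N#B─N m∈B∩N m∈B─N = proj₂ (x∈p─q⁻ B N m∈B─N) (proj₂ (x∈p∩q⁻ B N m∈B∩N))

  -- Without tight sets, any edge i₀ – a can be removed without breaking Hall's condition.
  looseMatching : ∀ {A B i₀} → SmallerMatchings A → HallCondition A B → i₀ ∈ A →
                  (∀ I → ¬ Tight A B I) → Matching A B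
  looseMatching {A} {B} {i₀} smaller hc i₀∈A ¬tight =
    glueMatchings (singletonMatching Ri₀a) M′ A⊆i₀∪A-i₀ a⊆B (p─q⊆p B ⁅ a ⁆) a#B-a
    where
    N₀ = B ∩ neighbours ⁅ i₀ ⁆

    a∈N₀ : Nonempty N₀
    a∈N₀ = 0<∣p∣⇒Nonempty (≤-trans (≤-reflexive (sym (∣⁅x⁆∣≡1 i₀))) (hc ⁅ i₀ ⁆ i₀⊆A))
      where
      i₀⊆A : ⁅ i₀ ⁆ ⊆ A
      i₀⊆A i∈⁅i₀⁆ = subst (_∈ A) (sym (x∈⁅y⁆⇒x≡y i₀ i∈⁅i₀⁆)) i₀∈A

    a = proj₁ a∈N₀

    a⊆B : ⁅ a ⁆ ⊆ B
    a⊆B m∈⁅a⁆ = subst (_∈ B) (sym (x∈⁅y⁆⇒x≡y a m∈⁅a⁆)) (proj₁ (x∈p∩q⁻ B _ (proj₂ a∈N₀)))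

    Ri₀a : R i₀ a
    Ri₀a with ∈-neighbours⁻ (proj₂ (x∈p∩q⁻ B _ (proj₂ a∈N₀)))
    ... | i , i∈⁅i₀⁆ , Ria = subst (λ i → R i a) (x∈⁅y⁆⇒x≡y i₀ i∈⁅i₀⁆) Ria

    hc′ : HallCondition (A - i₀) (B - a)
    hc′ J J⊆A-i₀ with nonempty? J
    ... | no  J-empty    = subst (_≤ ∣ (B - a) ∩ neighbours J ∣) (sym (Empty⇒∣p∣≡0 J-empty)) z≤n
    ... | yes J-nonempty = ≤-pred (begin-strict
      ∣ J ∣                                 <⟨ ≰⇒> (λ J-tight → ¬tight J (J⊂A , J-nonempty , J-tight)) ⟩
      ∣ B ∩ neighbours J ∣                  ≤⟨ p⊆q⇒∣p∣≤∣q∣ split ⟩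
      ∣ ⁅ a ⁆ ∪ ((B - a) ∩ neighbours J) ∣  ≤⟨ ∣p∪q∣≤∣p∣+∣q∣ ⁅ a ⁆ _ ⟩
      ∣ ⁅ a ⁆ ∣ + ∣ (B - a) ∩ neighbours J ∣ ≡⟨ cong (_+ ∣ (B - a) ∩ neighbours J ∣) (∣⁅x⁆∣≡1 a) ⟩
      suc ∣ (B - a) ∩ neighbours J ∣        ∎)
      where
      open ≤-Reasoning
      J⊂A : J ⊂ A
      J⊂A = p─q⊆p A ⁅ i₀ ⁆ ∘ J⊆A-i₀ , i₀ , i₀∈A , λ i₀∈J → proj₂ (x∈p─q⁻ A ⁅ i₀ ⁆ (J⊆A-i₀ i₀∈J)) (x∈⁅x⁆ i₀)
      split : B ∩ neighbours J ⊆ ⁅ a ⁆ ∪ ((B - a) ∩ neighbours J)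
      split {m} m∈ with x∈p∩q⁻ B _ m∈ | m ≟ a
      ... | _         | yes refl = x∈p∪q⁺ (inj₁ (x∈⁅x⁆ a))
      ... | m∈B , m∈NJ | no  m≢a = x∈p∪q⁺ (inj₂ (x∈p∩q⁺ (x∈p∧x≢y⇒x∈p-y m∈B m≢a , m∈NJ)))

    M′ : Matching (A - i₀) (B - a)
    M′ = smaller (B - a) (x∈p⇒∣p-x∣<∣p∣ i₀∈A) hc′

    A⊆i₀∪A-i₀ : A ⊆ ⁅ i₀ ⁆ ∪ (A - i₀)
    A⊆i₀∪A-i₀ {i} i∈A with i ≟ i₀
    ... | yes refl = x∈p∪q⁺ (inj₁ (x∈⁅x⁆ i₀))
    ... | no  i≢i₀ = x∈p∪q⁺ (inj₂ (x∈p∧x≢y⇒x∈p-y i∈A i≢i₀))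

    a#B-a : Disjoint ⁅ a ⁆ (B - a)
    a#B-a m∈⁅a⁆ m∈B-a = proj₂ (x∈p─q⁻ B ⁅ a ⁆ m∈B-a) m∈⁅a⁆

  matching : ∀ A B → Fin s → Acc _<_ ∣ A ∣ → HallCondition A B → Matching A B
  matching A B d (acc smaller) hc = byCases (nonempty? A) (anySubset? (tight? A B))
    where
    recurse : SmallerMatchings A
    recurse B′ ∣A′∣<∣A∣ hc′ = matching _ B′ d (smaller ∣A′∣<∣A∣) hc′

    byCases : Dec (Nonempty A) → Dec (∃ (Tight A B)) → Matching A B
    byCases (no A-empty)        _                 = emptyMatching d A-empty
    byCases (yes (_ , i₀∈A)) (yes (_ , I-tight)) = tightMatching recurse hc I-tight
    byCases (yes (_ , i₀∈A)) (no ∄tight)         =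
      looseMatching recurse hc i₀∈A (λ I I-tight → ∄tight (I , I-tight))

hall : ∀ {r k s} (R : Fin k → Fin s → Set r) (R? : ∀ i m → Dec (R i m)) →
       (∀ I → ∣ I ∣ ≤ ∣ neighbours R R? I ∣) →
       ∃ λ (c : Fin k → Fin s) → (∀ i → R i (c i)) × Injective _≡_ _≡_ c
hall {k = zero}  R R? hc = (λ ()) , (λ ()) , λ {}
hall {k = suc k} {s} R R? hc = match , (λ i → match-R ∈⊤) , match-inj ∈⊤ ∈⊤
  where
  hc⊤ : HallCondition R R? ⊤ ⊤
  hc⊤ I _ rewrite ∩-identityˡ (neighbours R R? I) = hc I
  d : Fin s
  d = proj₁ (0<∣p∣⇒Nonempty {p = neighbours R R? ⁅ zero ⁆}
              (≤-trans (≤-reflexive (sym (∣⁅x⁆∣≡1 (zero {k})))) (hc ⁅ zero ⁆)))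
  open Matching (matching R R? ⊤ ⊤ d (<-wellFounded _) hc⊤)

-- Powers and orbits in a semigroup

module _ {c ℓ : Level} (S : Semigroup c ℓ) where

  open Semigroup S renaming (refl to ≈-refl; sym to ≈-sym; trans to ≈-trans)
  open import Relation.Binary.Reasoning.Setoid setoid

  -- u ^⁺ n = u^(n+1), the only powers that exist in a semigroup
  _^⁺_ : Carrier → ℕ → Carrier
  u ^⁺ zero  = u
  u ^⁺ suc n = (u ^⁺ n) ∙ u

  ^⁺-homo : ∀ u m n → ((u ^⁺ m) ∙ (u ^⁺ n)) ≈ (u ^⁺ (n + suc m))
  ^⁺-homo u m zero    = ≈-refl
  ^⁺-homo u m (suc n) = ≈-trans (≈-sym (assoc _ _ _)) (∙-congʳ (^⁺-homo u m n))

  module _ {e : Carrier} (identity : IsIdentity S e) {u : Carrier} {d : ℕ} (period : (u ^⁺ d) ≈ e) where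

    ^⁺-reduce : ∀ n → ∃ λ r → r ≤ d × (u ^⁺ n) ≈ (u ^⁺ r)
    ^⁺-reduce zero = zero , z≤n , ≈-refl
    ^⁺-reduce (suc n) with ^⁺-reduce n
    ... | r , r≤d , uⁿ≈uʳ with m≤n⇒m<n∨m≡n r≤d
    ...   | inj₁ r<d  = suc r , r<d , ∙-congʳ uⁿ≈uʳ
    ...   | inj₂ refl = zero , z≤n , (begin
      (u ^⁺ n) ∙ u ≈⟨ ∙-congʳ (≈-trans uⁿ≈uʳ period) ⟩
      e ∙ u        ≈⟨ proj₁ (identity u) ⟩
      u            ∎)

    powers-reduce : ∀ {a} → Gen S (_≈ u) a → ∃ λ r → r ≤ d × a ≈ (u ^⁺ r)
    powers-reduce (base a≈u) = zero , z≤n , a≈u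
    powers-reduce (add a∈⟨u⟩ b∈⟨u⟩) with powers-reduce a∈⟨u⟩ | powers-reduce b∈⟨u⟩
    ... | r₁ , _ , a≈ | r₂ , _ , b≈ with ^⁺-reduce (r₂ + suc r₁)
    ...   | r , r≤d , ≈uʳ = r , r≤d , ≈-trans (∙-cong a≈ b≈) (≈-trans (^⁺-homo u r₁ r₂) ≈uʳ)
    powers-reduce (resp a≈b a∈⟨u⟩) with powers-reduce a∈⟨u⟩
    ... | r , r≤d , a≈ = r , r≤d , ≈-trans (≈-sym a≈b) a≈

    -- ⟨u⟩ ⊆ {u, …, u^(d+1)}, so it cannot contain n + 1 > d + 1 distinct elements.
    ordGT⇒≤period : ∀ {n} → OrdGT S n u → n ≤ d
    ordGT⇒≤period {n} (F , F∈⟨u⟩ , F-inj) = ≮⇒≥ λ d<n →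
      let i , j , i<j , indexᵢ≡indexⱼ = pigeonhole (s≤s d<n) index in
      <-irrefl (cong toℕ (F-inj i j (begin
        F i                  ≈⟨ F≈u^⁺index i ⟩
        u ^⁺ toℕ (index i)   ≡⟨ cong (λ r → u ^⁺ toℕ r) indexᵢ≡indexⱼ ⟩
        u ^⁺ toℕ (index j)   ≈⟨ ≈-sym (F≈u^⁺index j) ⟩
        F j                  ∎))) i<j
      where
      reduced : ∀ q → ∃ λ r → r ≤ d × F q ≈ (u ^⁺ r)
      reduced q = powers-reduce (F∈⟨u⟩ q)

      index : Fin (suc n) → Fin (suc d)
      index q = fromℕ< (s≤s (proj₁ (proj₂ (reduced q))))

      F≈u^⁺index : ∀ q → F q ≈ (u ^⁺ toℕ (index q))
      F≈u^⁺index q = ≈-trans (proj₂ (proj₂ (reduced q)))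
        (reflexive (cong (u ^⁺_) (sym (toℕ-fromℕ< (s≤s (proj₁ (proj₂ (reduced q))))))))

  TranslationInvariant : ∀ {s p} → (Fin s → Carrier) → Carrier → Pred (Fin s) p → Set _
  TranslationInvariant f u P = ∀ {t} → P t → ∃ λ m → P m × (f t ∙ u) ≈ f m

  module _ (cancelˡ : LeftCancellative _≈_ _∙_) {e : Carrier} (identity : IsIdentity S e)
           {s : ℕ} (f : Fin s → Carrier) (u : Carrier) where

    -- Two points of an orbit of length s + 1 coincide, and cancelling the earlier one leaves e.
    invariant⇒periodic : ∀ {p} (P : Pred (Fin s) p) → ∃ P → TranslationInvariant f u P →
                         ∃ λ d → d < s × (u ^⁺ d) ≈ e
    invariant⇒periodic P (t₀ , Pt₀) invariant = d , d<s , period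
      where
      orbit : ℕ → ∃ P
      orbit zero    = t₀ , Pt₀
      orbit (suc n) = let m , Pm , _ = invariant (proj₂ (orbit n)) in m , Pm

      point : ℕ → Carrier
      point n = f (proj₁ (orbit n))

      orbit-shift : ∀ n p → point (suc n + p) ≈ (point p ∙ (u ^⁺ n))
      orbit-shift zero    p = ≈-sym (proj₂ (proj₂ (invariant (proj₂ (orbit p)))))
      orbit-shift (suc n) p = begin
        point (suc (suc n + p))    ≈⟨ orbit-shift zero (suc n + p) ⟩
        point (suc n + p) ∙ u      ≈⟨ ∙-congʳ (orbit-shift n p) ⟩
        (point p ∙ (u ^⁺ n)) ∙ u   ≈⟨ assoc _ _ _ ⟩
        point p ∙ (u ^⁺ suc n)     ∎

      collision = pigeonhole (n<1+n s) (λ (q : Fin (suc s)) → proj₁ (orbit (toℕ q)))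
      i = toℕ (proj₁ collision)
      j = toℕ (proj₁ (proj₂ collision))
      gap = m≤n⇒∃[o]m+o≡n (proj₁ (proj₂ (proj₂ collision)))
      d = proj₁ gap

      j≡1+d+i : j ≡ suc d + i
      j≡1+d+i = trans (sym (proj₂ gap)) (cong suc (+-comm i d))

      d<s : d < s
      d<s = ≤-<-trans (m≤m+n d i) (≤-pred (subst (_< suc s) j≡1+d+i (toℕ<n (proj₁ (proj₂ collision)))))

      period : (u ^⁺ d) ≈ e
      period = ≈-sym (cancelˡ (point i) e (u ^⁺ d) (begin
        point i ∙ e           ≈⟨ proj₂ (identity (point i)) ⟩
        point i               ≡⟨ cong f (proj₂ (proj₂ (proj₂ collision))) ⟩
        point j               ≡⟨ cong point j≡1+d+i ⟩
        point (suc d + i)     ≈⟨ orbit-shift d i ⟩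
        point i ∙ (u ^⁺ d)    ∎))

    ordGT⇒¬invariant : ∀ {p} (P : Pred (Fin s) p) → OrdGT S s u → ∃ P → ¬ TranslationInvariant f u P
    ordGT⇒¬invariant P ord nonempty invariant =
      let d , d<s , period = invariant⇒periodic P nonempty invariant
      in <⇒≱ d<s (ordGT⇒≤period identity period ord)

-- Dyson's e-transform

module PartialAction {a : Level} {s l : ℕ} (Step : Fin s → Fin l → Fin s → Set a) (j₀ : Fin l)
  (step-functional : ∀ {t j m m′} → Step t j m → Step t j m′ → m ≡ m′)
  (step-cancel     : ∀ {t j j′ m} → Step t j m → Step t j′ m → j ≡ j′)
  (step-identity   : ∀ t → Step t j₀ t)
  (step-comm       : ∀ {t i j m n m′} → Step t i m → Step m j n → Step t j m′ → Step m′ i n)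
  (step-aperiodic  : ∀ {j} → j ≢ j₀ → ∀ X → Nonempty X →
                     ¬ (∀ {t} → t ∈ X → ∃ λ m → m ∈ X × Step t j m))
  where

  SumsIn : Subset s → Subset l → (Fin s → Fin l → Fin s) → Subset s → Set a
  SumsIn X Y g Z = ∀ {t j} → t ∈ X → j ∈ Y → Step t j (g t j) × g t j ∈ Z

  record Reduced (X : Subset s) (Y : Subset l) (Z : Subset s) : Set a where
    field
      X′        : Subset s
      Y′        : Subset l
      g′        : Fin s → Fin l → Fin s
      X′≠∅      : Nonempty X′
      j₀∈Y′     : j₀ ∈ Y′
      sums′     : SumsIn X′ Y′ g′ Z
      ∣Y′∣<∣Y∣  : ∣ Y′ ∣ < ∣ Y ∣
      ∣X∣+∣Y∣≤∣X′∣+∣Y′∣ : ∣ X ∣ + ∣ Y ∣ ≤ ∣ X′ ∣ + ∣ Y′ ∣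

  -- The e-transform at x₀, writing t + j for g t j: X′ = X ∪ (x₀ + Y), Y′ = {j ∈ Y | x₀ + j ∈ X}.
  eTransform : ∀ {X Y Z g x₀ a₀} → SumsIn X Y g Z → j₀ ∈ Y → x₀ ∈ X → a₀ ∈ Y → g x₀ a₀ ∉ X →
               Reduced X Y Z
  eTransform {X} {Y} {Z} {g} {x₀} {a₀} sums j₀∈Y x₀∈X a₀∈Y x₀+a₀∉X = record
    { X′ = X ∪ image (g x₀) Y ; Y′ = Y′ ; g′ = g′
    ; X′≠∅ = x₀ , x∈p∪q⁺ (inj₁ x₀∈X)
    ; j₀∈Y′ = x∈p∩q⁺ (j₀∈Y , ∈-fromDec⁺ (λ j → g x₀ j ∈? X) (subst (_∈ X) (sym x₀+j₀≡x₀) x₀∈X))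
    ; sums′ = sums′
    ; ∣Y′∣<∣Y∣ = p⊂q⇒∣p∣<∣q∣ (Y′⊆Y , a₀ , a₀∈Y , λ a₀∈Y′ → x₀+a₀∉X (x₀+Y′⊆X a₀∈Y′))
    ; ∣X∣+∣Y∣≤∣X′∣+∣Y′∣ = count
    }
    where
    Y′ = Y ∩ fromDec (λ j → g x₀ j ∈? X)

    Y′⊆Y : Y′ ⊆ Y
    Y′⊆Y = p∩q⊆p Y _

    x₀+Y′⊆X : ∀ {j} → j ∈ Y′ → g x₀ j ∈ X
    x₀+Y′⊆X j∈Y′ = ∈-fromDec⁻ (λ j → g x₀ j ∈? X) (proj₂ (x∈p∩q⁻ Y _ j∈Y′))

    x₀+j₀≡x₀ : g x₀ j₀ ≡ x₀
    x₀+j₀≡x₀ = step-functional (proj₁ (sums x₀∈X j₀∈Y)) (step-identity x₀)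

    back : Fin s → Fin l
    back = preimage (g x₀) Y j₀

    -- A new point t = x₀ + back t is translated by j as (x₀ + j) + back t.
    g′ : Fin s → Fin l → Fin s
    g′ t j with t ∈? X
    ... | yes _ = g t j
    ... | no  _ = g (g x₀ j) (back t)

    sums′ : SumsIn (X ∪ image (g x₀) Y) Y′ g′ Z
    sums′ {t} {j} t∈X′ j∈Y′ with t ∈? X
    ... | yes t∈X = sums t∈X (Y′⊆Y j∈Y′)
    ... | no  t∉X with x∈p∪q⁻ X _ t∈X′
    ...   | inj₁ t∈X     = contradiction t∈X t∉X
    ...   | inj₂ t∈x₀+Y  =
      let i∈Y , x₀+i≡t = preimage-spec (g x₀) j₀ t∈x₀+Y
          step , ∈Z = sums (x₀+Y′⊆X j∈Y′) i∈Y
      in step-comm (proj₁ (sums x₀∈X (Y′⊆Y j∈Y′))) step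
                   (subst (Step x₀ (back t)) x₀+i≡t (proj₁ (sums x₀∈X i∈Y))) , ∈Z

    D = Y ─ Y′

    count : ∣ X ∣ + ∣ Y ∣ ≤ ∣ X ∪ image (g x₀) Y ∣ + ∣ Y′ ∣
    count = begin
      ∣ X ∣ + ∣ Y ∣                              ≤⟨ +-monoʳ-≤ ∣ X ∣ ∣Y∣≤∣Y′∣+∣D∣ ⟩
      ∣ X ∣ + (∣ Y′ ∣ + ∣ D ∣)                   ≤⟨ +-monoʳ-≤ ∣ X ∣ (+-monoʳ-≤ ∣ Y′ ∣ ∣D∣≤∣x₀+D∣) ⟩
      ∣ X ∣ + (∣ Y′ ∣ + ∣ image (g x₀) D ∣)      ≡⟨ cong (∣ X ∣ +_) (+-comm ∣ Y′ ∣ _) ⟩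
      ∣ X ∣ + (∣ image (g x₀) D ∣ + ∣ Y′ ∣)      ≡⟨ +-assoc (∣ X ∣) _ (∣ Y′ ∣) ⟨
      (∣ X ∣ + ∣ image (g x₀) D ∣) + ∣ Y′ ∣      ≡⟨ cong (_+ ∣ Y′ ∣) (disjoint⇒∣p∣+∣q∣≡∣p∪q∣ X _ X#x₀+D) ⟩
      ∣ X ∪ image (g x₀) D ∣ + ∣ Y′ ∣          ≤⟨ +-monoˡ-≤ ∣ Y′ ∣ (p⊆q⇒∣p∣≤∣q∣ X∪x₀+D⊆X′) ⟩
      ∣ X ∪ image (g x₀) Y ∣ + ∣ Y′ ∣            ∎
      where
      open ≤-Reasoning
      ∣Y∣≤∣Y′∣+∣D∣ : ∣ Y ∣ ≤ ∣ Y′ ∣ + ∣ D ∣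
      ∣Y∣≤∣Y′∣+∣D∣ = ≤-trans (p⊆q⇒∣p∣≤∣q∣ (p⊆q∪p─q Y Y′)) (∣p∪q∣≤∣p∣+∣q∣ Y′ D)
      ∣D∣≤∣x₀+D∣ : ∣ D ∣ ≤ ∣ image (g x₀) D ∣
      ∣D∣≤∣x₀+D∣ = ∣p∣≤∣image∣ (g x₀) D λ i∈D j∈D x₀+i≡x₀+j →
        step-cancel (proj₁ (sums x₀∈X (p─q⊆p Y Y′ i∈D)))
                    (subst (Step x₀ _) (sym x₀+i≡x₀+j) (proj₁ (sums x₀∈X (p─q⊆p Y Y′ j∈D))))
      X#x₀+D : Disjoint X (image (g x₀) D)
      X#x₀+D t∈X t∈x₀+D with ∈-image⁻ (g x₀) t∈x₀+D
      ... | j , j∈D , refl = let j∈Y , j∉Y′ = x∈p─q⁻ Y Y′ j∈D in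
        j∉Y′ (x∈p∩q⁺ (j∈Y , ∈-fromDec⁺ (λ j → g x₀ j ∈? X) t∈X))
      X∪x₀+D⊆X′ : X ∪ image (g x₀) D ⊆ X ∪ image (g x₀) Y
      X∪x₀+D⊆X′ = ∪-least (p⊆p∪q _) (q⊆p∪q X _ ∘ image-mono (g x₀) (p─q⊆p Y Y′))

  sumsetBound-acc : ∀ {X Y Z} g → Acc _<_ ∣ Y ∣ → Nonempty X → j₀ ∈ Y → SumsIn X Y g Z →
                    ∣ X ∣ + ∣ Y ∣ ≤ suc ∣ Z ∣
  sumsetBound-acc {X} {Y} {Z} g (acc smaller) X≠∅ j₀∈Y sums =
    byCases (any? λ j → j ∈? Y ×-dec ¬? (j ≟ j₀))
            (any? λ t → t ∈? X ×-dec any? λ j → j ∈? Y ×-dec ¬? (g t j ∈? X))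
    where
    byCases : Dec (∃ λ j → j ∈ Y × j ≢ j₀) → Dec (∃ λ t → t ∈ X × ∃ λ j → j ∈ Y × g t j ∉ X) →
              ∣ X ∣ + ∣ Y ∣ ≤ suc ∣ Z ∣
    byCases (no ∄j≢j₀) _ = begin
      ∣ X ∣ + ∣ Y ∣    ≤⟨ +-mono-≤ (p⊆q⇒∣p∣≤∣q∣ X⊆Z) ∣Y∣≤1 ⟩
      ∣ Z ∣ + 1        ≡⟨ +-comm ∣ Z ∣ 1 ⟩
      suc ∣ Z ∣        ∎
      where
      open ≤-Reasoning
      X⊆Z : X ⊆ Z
      X⊆Z t∈X = let step , ∈Z = sums t∈X j₀∈Y in
        subst (_∈ Z) (step-functional step (step-identity _)) ∈Z
      ∣Y∣≤1 : ∣ Y ∣ ≤ 1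
      ∣Y∣≤1 = ≤-trans (p⊆q⇒∣p∣≤∣q∣ Y⊆j₀) (≤-reflexive (∣⁅x⁆∣≡1 j₀))
        where
        Y⊆j₀ : Y ⊆ ⁅ j₀ ⁆
        Y⊆j₀ {j} j∈Y = subst (_∈ ⁅ j₀ ⁆)
          (sym (decidable-stable (j ≟ j₀) λ j≢j₀ → ∄j≢j₀ (j , j∈Y , j≢j₀))) (x∈⁅x⁆ j₀)
    byCases (yes (j₁ , j₁∈Y , j₁≢j₀)) (no X+Y⊆X) = ⊥-elim (step-aperiodic j₁≢j₀ X X≠∅ λ {t} t∈X →
      g t j₁ , decidable-stable (g t j₁ ∈? X) (λ t+j₁∉X → X+Y⊆X (t , t∈X , j₁ , j₁∈Y , t+j₁∉X)) ,
      proj₁ (sums t∈X j₁∈Y))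
    byCases _ (yes (x₀ , x₀∈X , a₀ , a₀∈Y , x₀+a₀∉X)) =
      ≤-trans ∣X∣+∣Y∣≤∣X′∣+∣Y′∣ (sumsetBound-acc g′ (smaller ∣Y′∣<∣Y∣) X′≠∅ j₀∈Y′ sums′)
      where open Reduced (eTransform sums j₀∈Y x₀∈X a₀∈Y x₀+a₀∉X)

  sumsetBound : ∀ {X Y Z} g → Nonempty X → j₀ ∈ Y → SumsIn X Y g Z → ∣ X ∣ + ∣ Y ∣ ≤ suc ∣ Z ∣
  sumsetBound g = sumsetBound-acc g (<-wellFounded _)

-- The matrix α(X, Y)

module _ {c ℓ : Level} (S : Semigroup c ℓ) where

  open Semigroup S renaming (refl to ≈-refl; sym to ≈-sym; trans to ≈-trans)

  HasSize-⊎ : ∀ {m n} (f : Fin m → Carrier) (g : Fin n → Carrier) → InjectiveEnum S f → InjectiveEnum S g →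
              (∀ i j → ¬ f i ≈ g j) → HasSize S (λ a → Img S f a ⊎ Img S g a) (m + n)
  HasSize-⊎ {m} {n} f g f-inj g-inj f#g = h , h∈ , h-inj , h-complete
    where
    [f,g] : Fin m ⊎ Fin n → Carrier
    [f,g] = [ f , g ]′

    h : Fin (m + n) → Carrier
    h = [f,g] ∘ splitAt m

    h∈ : ∀ w → Img S f (h w) ⊎ Img S g (h w)
    h∈ w with splitAt m w
    ... | inj₁ i = inj₁ (i , ≈-refl)
    ... | inj₂ j = inj₂ (j , ≈-refl)

    [f,g]-inj : ∀ v w → [f,g] v ≈ [f,g] w → v ≡ w
    [f,g]-inj (inj₁ i) (inj₁ i′) eq = cong inj₁ (f-inj i i′ eq)
    [f,g]-inj (inj₂ j) (inj₂ j′) eq = cong inj₂ (g-inj j j′ eq)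
    [f,g]-inj (inj₁ i) (inj₂ j)  eq = contradiction eq (f#g i j)
    [f,g]-inj (inj₂ j) (inj₁ i)  eq = contradiction (≈-sym eq) (f#g i j)

    h-inj : InjectiveEnum S h
    h-inj w w′ eq = trans (sym (join-splitAt m n w))
                      (trans (cong (join m n) ([f,g]-inj (splitAt m w) (splitAt m w′) eq)) (join-splitAt m n w′))

    h-complete : ∀ a → Img S f a ⊎ Img S g a → ∃ λ w → a ≈ h w
    h-complete a (inj₁ (i , a≈fi)) = i ↑ˡ n , ≈-trans a≈fi (reflexive (cong [f,g] (sym (splitAt-↑ˡ m i n))))
    h-complete a (inj₂ (j , a≈gj)) = m ↑ʳ j , ≈-trans a≈gj (reflexive (cong [f,g] (sym (splitAt-↑ʳ m n j))))

module Matrix {c ℓ : Level} (S : Semigroup c ℓ) (cancel : IsCancellative S) where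

  open Semigroup S renaming (refl to ≈-refl; sym to ≈-sym; trans to ≈-trans)

  module Differences {l : ℕ} (y : Fin l → Carrier) (y-comm : Commutative S (Gen S (Img S y)))
    {e : Carrier} (identity : IsIdentity S e) (j₀ : Fin l) {ỹ : Carrier}
    (y₀ỹ≈e : (y j₀ ∙ ỹ) ≈ e) (ỹy₀≈e : (ỹ ∙ y j₀) ≈ e)
    where

    open import Relation.Binary.Reasoning.Setoid setoid

    y₀ = y j₀

    u : Fin l → Carrier
    u j = y j ∙ ỹ

    yᵢyⱼ≈yⱼyᵢ : ∀ i j → (y i ∙ y j) ≈ (y j ∙ y i)
    yᵢyⱼ≈yⱼyᵢ i j = y-comm (y i) (y j) (base (i , ≈-refl)) (base (j , ≈-refl))

    ỹy≈yỹ : ∀ j → (ỹ ∙ y j) ≈ (y j ∙ ỹ)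
    ỹy≈yỹ j = begin
      ỹ ∙ y j                    ≈⟨ proj₂ (identity _) ⟨
      (ỹ ∙ y j) ∙ e              ≈⟨ ∙-congˡ y₀ỹ≈e ⟨
      (ỹ ∙ y j) ∙ (y₀ ∙ ỹ)       ≈⟨ assoc _ _ _ ⟩
      ỹ ∙ (y j ∙ (y₀ ∙ ỹ))       ≈⟨ ∙-congˡ (assoc _ _ _) ⟨
      ỹ ∙ ((y j ∙ y₀) ∙ ỹ)       ≈⟨ ∙-congˡ (∙-congʳ (yᵢyⱼ≈yⱼyᵢ j j₀)) ⟩
      ỹ ∙ ((y₀ ∙ y j) ∙ ỹ)       ≈⟨ ∙-congˡ (assoc _ _ _) ⟩
      ỹ ∙ (y₀ ∙ (y j ∙ ỹ))       ≈⟨ assoc _ _ _ ⟨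
      (ỹ ∙ y₀) ∙ (y j ∙ ỹ)       ≈⟨ ∙-congʳ ỹy₀≈e ⟩
      e ∙ (y j ∙ ỹ)              ≈⟨ proj₁ (identity _) ⟩
      y j ∙ ỹ                    ∎

    uᵢuⱼ≈yᵢyⱼỹỹ : ∀ i j → (u i ∙ u j) ≈ ((y i ∙ y j) ∙ (ỹ ∙ ỹ))
    uᵢuⱼ≈yᵢyⱼỹỹ i j = begin
      (y i ∙ ỹ) ∙ (y j ∙ ỹ)      ≈⟨ assoc _ _ _ ⟩
      y i ∙ (ỹ ∙ (y j ∙ ỹ))      ≈⟨ ∙-congˡ (assoc _ _ _) ⟨
      y i ∙ ((ỹ ∙ y j) ∙ ỹ)      ≈⟨ ∙-congˡ (∙-congʳ (ỹy≈yỹ j)) ⟩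
      y i ∙ ((y j ∙ ỹ) ∙ ỹ)      ≈⟨ ∙-congˡ (assoc _ _ _) ⟩
      y i ∙ (y j ∙ (ỹ ∙ ỹ))      ≈⟨ assoc _ _ _ ⟨
      (y i ∙ y j) ∙ (ỹ ∙ ỹ)      ∎

    uᵢuⱼ≈uⱼuᵢ : ∀ i j → (u i ∙ u j) ≈ (u j ∙ u i)
    uᵢuⱼ≈uⱼuᵢ i j = ≈-trans (uᵢuⱼ≈yᵢyⱼỹỹ i j) (≈-trans (∙-congʳ (yᵢyⱼ≈yⱼyᵢ i j)) (≈-sym (uᵢuⱼ≈yᵢyⱼỹỹ j i)))

    ∙u-translate : ∀ a j → ((a ∙ y₀) ∙ u j) ≈ (a ∙ y j)
    ∙u-translate a j = begin
      (a ∙ y₀) ∙ (y j ∙ ỹ)       ≈⟨ assoc _ _ _ ⟩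
      a ∙ (y₀ ∙ (y j ∙ ỹ))       ≈⟨ ∙-congˡ (assoc _ _ _) ⟨
      a ∙ ((y₀ ∙ y j) ∙ ỹ)       ≈⟨ ∙-congˡ (∙-congʳ (yᵢyⱼ≈yⱼyᵢ j₀ j)) ⟩
      a ∙ ((y j ∙ y₀) ∙ ỹ)       ≈⟨ ∙-congˡ (assoc _ _ _) ⟩
      a ∙ (y j ∙ (y₀ ∙ ỹ))       ≈⟨ ∙-congˡ (∙-congˡ y₀ỹ≈e) ⟩
      a ∙ (y j ∙ e)              ≈⟨ ∙-congˡ (proj₂ (identity _)) ⟩
      a ∙ y j                    ∎

    ∙u₀ : ∀ a → (a ∙ u j₀) ≈ a
    ∙u₀ a = ≈-trans (∙-congˡ y₀ỹ≈e) (proj₂ (identity a))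

    ∙u-cancel : ∀ a i j → (a ∙ u i) ≈ (a ∙ u j) → y i ≈ y j
    ∙u-cancel a i j eq = proj₂ cancel ỹ (y i) (y j) (proj₁ cancel a (u i) (u j) eq)

  module Rows {k l s : ℕ}
    (x : Fin k → Carrier) (x-inj : InjectiveEnum S x)
    (y : Fin l → Carrier) (y-inj : InjectiveEnum S y) (y-comm : Commutative S (Gen S (Img S y)))
    (f : Fin s → Carrier) (f-inj : InjectiveEnum S f) (f-complete : ∀ a → Sumset S x y a → ∃ λ t → a ≈ f t)
    {e : Carrier} (identity : IsIdentity S e) (j₀ : Fin l) {ỹ : Carrier}
    (y₀ỹ≈e : (y j₀ ∙ ỹ) ≈ e) (ỹy₀≈e : (ỹ ∙ y j₀) ≈ e)
    (ord : ∀ j → ¬ y j ≈ y j₀ → OrdGT S s (y j ∙ ỹ))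
    where

    open Differences y y-comm identity j₀ y₀ỹ≈e ỹy₀≈e

    -- σ i j is the position of the entry x i ∙ y j of α(X, Y) in the enumeration f of X + Y.
    σ : Fin k → Fin l → Fin s
    σ i j = proj₁ (f-complete (x i ∙ y j) (i , j , ≈-refl))

    xy≈fσ : ∀ i j → (x i ∙ y j) ≈ f (σ i j)
    xy≈fσ i j = proj₂ (f-complete (x i ∙ y j) (i , j , ≈-refl))

    σ-injectiveˡ : ∀ j {i i′} → σ i j ≡ σ i′ j → i ≡ i′
    σ-injectiveˡ j {i} {i′} σij≡σi′j = x-inj i i′ (proj₂ cancel (y j) (x i) (x i′)
      (≈-trans (xy≈fσ i j) (≈-trans (reflexive (cong f σij≡σi′j)) (≈-sym (xy≈fσ i′ j)))))

    Step : Fin s → Fin l → Fin s → Set ℓ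
    Step t j m = (f t ∙ u j) ≈ f m

    step-comm : ∀ {t i j m n m′} → Step t i m → Step m j n → Step t j m′ → Step m′ i n
    step-comm {t} {i} {j} {m} {n} {m′} t+i≈m m+j≈n t+j≈m′ = begin
      f m′ ∙ u i          ≈⟨ ∙-congʳ t+j≈m′ ⟨
      (f t ∙ u j) ∙ u i   ≈⟨ assoc _ _ _ ⟩
      f t ∙ (u j ∙ u i)   ≈⟨ ∙-congˡ (uᵢuⱼ≈uⱼuᵢ j i) ⟩
      f t ∙ (u i ∙ u j)   ≈⟨ assoc _ _ _ ⟨
      (f t ∙ u i) ∙ u j   ≈⟨ ∙-congʳ t+i≈m ⟩
      f m ∙ u j           ≈⟨ m+j≈n ⟩
      f n                 ∎
      where open import Relation.Binary.Reasoning.Setoid setoid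

    open PartialAction Step j₀
      (λ t+j≈m t+j≈m′ → f-inj _ _ (≈-trans (≈-sym t+j≈m) t+j≈m′))
      (λ t+j≈m t+j′≈m → y-inj _ _ (∙u-cancel _ _ _ (≈-trans t+j≈m (≈-sym t+j′≈m))))
      (λ t → ∙u₀ (f t))
      step-comm
      (λ {j} j≢j₀ X → ordGT⇒¬invariant S (proj₁ cancel) identity f (u j) (_∈ X) (ord j (j≢j₀ ∘ y-inj j j₀)))

    InRow : Fin k → Fin s → Set
    InRow i m = ∃ λ j → σ i j ≡ m

    inRow? : ∀ i m → Dec (InRow i m)
    inRow? i m = any? λ j → σ i j ≟ m

    fσ-translate : ∀ i j → Step (σ i j₀) j (σ i j)
    fσ-translate i j = begin
      f (σ i j₀) ∙ u j      ≈⟨ ∙-congʳ (xy≈fσ i j₀) ⟨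
      (x i ∙ y j₀) ∙ u j    ≈⟨ ∙u-translate (x i) j ⟩
      x i ∙ y j             ≈⟨ xy≈fσ i j ⟩
      f (σ i j)             ∎
      where open import Relation.Binary.Reasoning.Setoid setoid

    -- The sumset inequality for the rows X_I = {x i | i ∈ I}, applied to the column X_I + y j₀.
    rowsBound : ∀ {I} → Nonempty I → ∣ I ∣ + l ≤ suc ∣ neighbours InRow inRow? I ∣
    rowsBound {I} (i₁ , i₁∈I) =
      ≤-trans (+-mono-≤ (∣p∣≤∣image∣ (λ i → σ i j₀) I λ _ _ → σ-injectiveˡ j₀) (≤-reflexive (sym (∣⊤∣≡n l))))
              (sumsetBound g (σ i₁ j₀ , ∈-image⁺ _ i₁∈I) ∈⊤ sums)
      where
      X₀ : Subset s
      X₀ = image (λ i → σ i j₀) I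

      row : Fin s → Fin k
      row = preimage (λ i → σ i j₀) I i₁

      g : Fin s → Fin l → Fin s
      g t j = σ (row t) j

      sums : SumsIn X₀ ⊤ g (neighbours InRow inRow? I)
      sums {t} {j} t∈X₀ _ =
        let row∈I , σrow≡t = preimage-spec (λ i → σ i j₀) i₁ t∈X₀
        in subst (λ t′ → Step t′ j (g t j)) σrow≡t (fσ-translate (row t) j) ,
           ∈-neighbours⁺ InRow inRow? row∈I (j , refl)

    module Transversal (0<l : 0 < l) (Z : Fin (l ∸ 1) → Carrier) (Z-inj : InjectiveEnum S Z)
             (Z⊆X+Y : ∀ p → Sumset S x y (Z p)) where

      ζ : Fin (l ∸ 1) → Fin s
      ζ p = proj₁ (f-complete (Z p) (Z⊆X+Y p))

      Z≈fζ : ∀ p → Z p ≈ f (ζ p)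
      Z≈fζ p = proj₂ (f-complete (Z p) (Z⊆X+Y p))

      Zs : Subset s
      Zs = image ζ ⊤

      Admissible : Fin k → Fin s → Set
      Admissible i m = InRow i m × m ∉ Zs

      admissible? : ∀ i m → Dec (Admissible i m)
      admissible? i m = inRow? i m ×-dec ¬? (m ∈? Zs)

      -- Removing the l − 1 entries of Z from the rows I leaves at least |I| of them.
      hallCondition : ∀ I → ∣ I ∣ ≤ ∣ neighbours Admissible admissible? I ∣
      hallCondition I with nonempty? I
      ... | no  I-empty = subst (_≤ ∣ N ∣) (sym (Empty⇒∣p∣≡0 I-empty)) z≤n
        where N = neighbours Admissible admissible? I
      ... | yes I≠∅     = +-cancelʳ-≤ l ∣ I ∣ ∣ N ∣ (begin
        ∣ I ∣ + l                      ≤⟨ rowsBound I≠∅ ⟩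
        suc ∣ neighbours InRow inRow? I ∣ ≤⟨ s≤s (p⊆q⇒∣p∣≤∣q∣ rows⊆N∪Zs) ⟩
        suc ∣ N ∪ Zs ∣                 ≤⟨ s≤s (∣p∪q∣≤∣p∣+∣q∣ N Zs) ⟩
        suc (∣ N ∣ + ∣ Zs ∣)           ≤⟨ s≤s (+-monoʳ-≤ ∣ N ∣ ∣Zs∣≤l∸1) ⟩
        suc (∣ N ∣ + (l ∸ 1))          ≡⟨ +-suc ∣ N ∣ (l ∸ 1) ⟨
        ∣ N ∣ + (1 + (l ∸ 1))          ≡⟨ cong (∣ N ∣ +_) (m+[n∸m]≡n 0<l) ⟩
        ∣ N ∣ + l                      ∎)
        where
        open ≤-Reasoning
        N = neighbours Admissible admissible? I
        ∣Zs∣≤l∸1 : ∣ Zs ∣ ≤ l ∸ 1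
        ∣Zs∣≤l∸1 = ≤-trans (∣image∣≤∣p∣ ζ ⊤) (≤-reflexive (∣⊤∣≡n (l ∸ 1)))
        rows⊆N∪Zs : neighbours InRow inRow? I ⊆ N ∪ Zs
        rows⊆N∪Zs {m} m∈rows with ∈-neighbours⁻ InRow inRow? m∈rows | m ∈? Zs
        ... | _                 | yes m∈Zs = x∈p∪q⁺ (inj₂ m∈Zs)
        ... | i , i∈I , inRow   | no  m∉Zs =
          x∈p∪q⁺ (inj₁ (∈-neighbours⁺ Admissible admissible? i∈I (inRow , m∉Zs)))

      transversal : ∃ λ (c : Fin k → Fin s) → (∀ i → Admissible i (c i)) × Injective _≡_ _≡_ c
      transversal = hall Admissible admissible? hallCondition

      match : Fin k → Fin s
      match = proj₁ transversal

      match-admissible : ∀ i → Admissible i (match i)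
      match-admissible = proj₁ (proj₂ transversal)

      match-injective : Injective _≡_ _≡_ match
      match-injective = proj₂ (proj₂ transversal)

      col : Fin k → Fin l
      col i = proj₁ (proj₁ (match-admissible i))

      entry : Fin k → Carrier
      entry i = x i ∙ y (col i)

      entry≈f∘match : ∀ i → entry i ≈ f (match i)
      entry≈f∘match i = ≈-trans (xy≈fσ i (col i)) (reflexive (cong f (proj₂ (proj₁ (match-admissible i)))))

      entry-inj : InjectiveEnum S entry
      entry-inj i i′ eq =
        match-injective (f-inj _ _ (≈-trans (≈-sym (entry≈f∘match i)) (≈-trans eq (entry≈f∘match i′))))

      Z#entry : ∀ p i → ¬ Z p ≈ entry i
      Z#entry p i Zp≈entry = proj₂ (match-admissible i) (subst (_∈ Zs) ζp≡match-i (∈-image⁺ ζ ∈⊤))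
        where
        ζp≡match-i : ζ p ≡ match i
        ζp≡match-i = f-inj _ _ (≈-trans (≈-sym (Z≈fζ p)) (≈-trans Zp≈entry (entry≈f∘match i)))

proposition6p2 : {c ℓ : Level} (S : Semigroup c ℓ) → IsCancellative S →
    (k l : ℕ) → 0 < k → 0 < l →
    (x : Fin k → Semigroup.Carrier S) → InjectiveEnum S x →
    (y : Fin l → Semigroup.Carrier S) → InjectiveEnum S y →
    Commutative S (Gen S (Img S y)) →
    (s : ℕ) → HasSize S (Sumset S x y) s → OmegaGT S s y →
    (Z : Fin (l ∸ 1) → Semigroup.Carrier S) → InjectiveEnum S Z →
    (∀ i → Sumset S x y (Z i)) →
    ∃ λ (col : Fin k → Fin l) →
      HasSize S (λ a → Img S Z a ⊎ ∃ λ i → Semigroup._≈_ S a (Semigroup._∙_ S (x i) (y (col i)))) (k + l ∸ 1)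
proposition6p2 S cancel k l _ 0<l x x-inj y y-inj y-comm s (f , _ , f-inj , f-complete)
               (e , identity , j₀ , ỹ , y₀ỹ≈e , ỹy₀≈e , ord) Z Z-inj Z⊆X+Y =
  col , subst (HasSize S _) (trans (+-comm (l ∸ 1) k) (sym (+-∸-assoc k 0<l)))
              (HasSize-⊎ S Z entry Z-inj entry-inj Z#entry)
  where
  open Matrix S cancel
  open Rows x x-inj y y-inj y-comm f f-inj f-complete identity j₀ y₀ỹ≈e ỹy₀≈e ord
  open Transversal 0<l Z Z-inj Z⊆X+Y
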